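{- For all integers $N\ge0$ and $j\ge0$, \[\sum_{\substack{\pi\in\mathcal{D}_{\le N}\\ \gamma(\pi)=j}} q^{\mathcal{E}(\pi)} = {N\brack j}_q,\qquad \sum_{\substack{\pi\in\mathcal{P}_{\le N}\\ \gamma(\pi)=j}} q^{\mathcal{E}(\pi)} = \frac{1}{(q;q)_j(q;q)_{N-j}}.\]
   Context: A partition $\pi=(\lambda_1,\lambda_2,\dots)$ is a finite non-increasing sequence of positive integers; the empty sequence is the unique partition of $0$. $\mathcal{P}_{\le N}$ is the set of partitions with all parts $\le N$, $\mathcal{D}_{\le N}$ the set of partitions into distinct parts all $\le N$. $\mathcal{E}(\pi)=\lambda_2+\lambda_4+\cdots$ and $\gamma(\pi)=\lambda_1-\lambda_2+\lambda_3-\lambda_4+\cdots$. $(a;q)_l=\prod_{i=0}^{l-1}(1-aq^i)$ and ${n+m\brack n}_q=\frac{(q;q)_{n+m}}{(q;q)_n(q;q)_m}$ for $n,m\ge0$, $0$ otherwise. Identities of formal power series in $q$. -}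

module Defs where

open import Data.Nat using (ℕ; zero; suc; _≤_; _<_; _>_; _≥_; _≤ᵇ_; _∸_; _≡ᵇ_)
open import Data.Integer using (ℤ; +_; -_) renaming (_+_ to _+ℤ_; _*_ to _*ℤ_; _-_ to _-ℤ_)
open import Data.Bool using (Bool; true; false; if_then_else_)
open import Data.List using (List; []; _∷_; length; upTo; map; zipWith; foldr)
open import Data.List.Relation.Unary.All using (All)
open import Data.List.Relation.Unary.Linked using (Linked)
open import Data.List.Relation.Unary.Unique.Propositional using (Unique)
open import Data.List.Membership.Propositional using (_∈_)
open import Data.Product using (Σ; _×_; _,_)
open import Function.Bundles using (_⇔_)
open import Relation.Binary.PropositionalEquality using (_≡_)

IsPartition : List ℕ → Set
IsPartition π = All (λ x → 1 ≤ x) π × Linked _≥_ π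

InP≤ : ℕ → List ℕ → Set
InP≤ N π = IsPartition π × All (λ x → x ≤ N) π

InD≤ : ℕ → List ℕ → Set
InD≤ N π = (IsPartition π × Linked _>_ π) × All (λ x → x ≤ N) π

ℰ : List ℕ → ℕ
ℰ []            = 0
ℰ (_ ∷ [])      = 0
ℰ (_ ∷ b ∷ rest) = b Data.Nat.+ ℰ rest

γ : List ℕ → ℤ
γ []             = + 0
γ (a ∷ [])       = + a
γ (a ∷ b ∷ rest) = (+ a -ℤ + b) +ℤ γ rest

Series : Set
Series = ℕ → ℤ

_≋_ : Series → Series → Set
f ≋ g = ∀ n → f n ≡ g n

sumℤ : List ℤ → ℤ
sumℤ = foldr _+ℤ_ (+ 0)

_⊛_ : Series → Series → Series
(f ⊛ g) n = sumℤ (map (λ i → f i *ℤ g (n ∸ i)) (upTo (suc n)))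

one : Series
one zero    = + 1
one (suc _) = + 0

zeroS : Series
zeroS _ = + 0

-- the polynomial 1 − q^m  (m ≥ 1)
oneMinusQ^ : ℕ → Series
oneMinusQ^ m zero    = + 1
oneMinusQ^ m (suc n) = if suc n ≡ᵇ m then - (+ 1) else + 0

qPoch : ℕ → Series
qPoch zero    = one
qPoch (suc l) = qPoch l ⊛ oneMinusQ^ (suc l)

-- multiplicative inverse of a series with constant term 1:
-- b₀ = 1, bₙ = − ∑_{i=1}^{n} aᵢ b_{n−i}.
-- invPrefix a n = [bₙ, b_{n−1}, …, b₀]
invPrefix : Series → ℕ → List ℤ
invPrefix a zero    = + 1 ∷ []
invPrefix a (suc n) =
  let bs = invPrefix a n in
  - sumℤ (zipWith _*ℤ_ (map (λ i → a (suc i)) (upTo (suc n))) bs) ∷ bs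

headℤ : List ℤ → ℤ
headℤ []      = + 0
headℤ (x ∷ _) = x

inv : Series → Series
inv a n = headℤ (invPrefix a n)

qBinom : ℕ → ℕ → Series
qBinom N j = if j ≤ᵇ N
             then (qPoch N ⊛ inv (qPoch j)) ⊛ inv (qPoch (N ∸ j))
             else zeroS

-- "the generating function ∑_{π ∈ S} q^{ℰ(π)} equals F":
-- for every k, the set {π ∈ S | ℰ(π) = k} is finite with exactly F k elements,
-- witnessed by a duplicate-free list enumerating it.
GenFun : (List ℕ → Set) → Series → Set
GenFun S F = ∀ k → Σ (List (List ℕ)) λ L →
  Unique L × (∀ π → (π ∈ L) ⇔ (S π × ℰ π ≡ k)) × (+ length L ≡ F k)

{-# OPTIONS --safe #-}
module Submission where

-- Let π be a partition with all parts ≤ N + 1. Either all its parts are ≤ N, or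
-- π = (N + 1) ∷ r, and then γ π = N + 1 − γ r and ℰ π = γ r + ℰ r (both identities hold
-- for every list of naturals). So the partitions with γ = j and largest part N + 1 are the
-- N + 1 ∷ r with γ r = s, where j + s = N + 1, and they carry q^s times the weight of r.
-- For distinct parts r ranges over 𝒟≤N, which gives q-Pascal's rule
-- [N+1, j] = [N, j] + q^s [N, s]. For unrestricted parts r ranges over 𝒫≤(N+1), which gives
-- 1/((q)_j (q)_s) = 1/((q)_j (q)_(s-1)) + q^s/((q)_s (q)_j), a consequence of
-- 1/(q)_s = 1/(q)_(s-1) + q^s/(q)_s. Both generating functions are then pinned down
-- coefficient by coefficient: by induction on N for [N, j], and on the weight ℰ, then N,
-- for 1/((q)_j (q)_m).

open import Defs
open import Level using (0ℓ)
open import Data.Bool using (true; false; if_then_else_)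
open import Data.Empty using (⊥-elim)
open import Data.Integer using (ℤ; +_; -_; _+_; _*_; _-_)
import Data.Integer.Properties as ℤ
open import Data.Integer.Tactic.RingSolver using (solve-∀)
open import Data.List using (List; []; _∷_; map; upTo; applyUpTo; zipWith; length; _++_)
open import Data.List.Properties
  using (map-applyUpTo; map-upTo; map-cong; length-++; length-map; ∷-injectiveʳ)
open import Data.List.Membership.Propositional using (_∈_)
open import Data.List.Membership.Propositional.Properties
  using (∈-++⁻; ∈-++⁺ˡ; ∈-++⁺ʳ; ∈-map⁻; ∈-map⁺)
open import Data.List.Relation.Unary.All as All using (All; []; _∷_)
open import Data.List.Relation.Unary.AllPairs using ([]; _∷_)
open import Data.List.Relation.Unary.Any using (here)
open import Data.List.Relation.Unary.Linked as Linked using (Linked; []; [-]; _∷_)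
open import Data.List.Relation.Unary.Linked.Properties using (Linked⇒All)
open import Data.List.Relation.Unary.Unique.Propositional using (Unique)
import Data.List.Relation.Unary.Unique.Propositional.Properties as Unique
open import Data.Nat
  using (ℕ; zero; suc; _≤_; _<_; _≥_; _>_; _∸_; _≤ᵇ_; _≡ᵇ_; z≤n; s≤s; s≤s⁻¹; _≤?_)
import Data.Nat as ℕ
open import Data.Nat.Induction using (<-rec)
open import Data.Nat.Properties
  using (≤-refl; ≤-trans; <-trans; <⇒≱; ≰⇒>; 1+n≰n; m≤n⇒m≤1+n; m≤n⇒m<n∨m≡n; m≤m+n; m<n+m;
         m∸n≤m; m+[n∸m]≡n; m+n∸m≡n; +-suc; +-comm; +-identityʳ; suc-injective; ≤⇒≤ᵇ; ≤ᵇ⇒≤)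
open import Data.Product using (Σ; _×_; _,_; proj₁; proj₂)
import Data.Product as Product
open import Data.Sum using (_⊎_; inj₁; inj₂)
open import Function using (_∘_)
open import Function.Bundles using (_⇔_; mk⇔; module Equivalence)
open import Relation.Binary.Bundles using (Setoid)
import Relation.Binary.Construct.Flip.Ord as Flip
open import Relation.Binary.PropositionalEquality
import Relation.Binary.Reasoning.Setoid as SetoidReasoning
open import Relation.Nullary using (¬_; yes; no)
open import Relation.Unary using (Pred; _∪_; _⊆_; _≐_; _⊥_; Empty)
open import Relation.Unary.Properties using (≐-refl; ≐-sym)

open Equivalence using (to; from)
open Setoid (ℕ →-setoid ℤ) using () renaming (refl to ≋-refl; sym to ≋-sym; trans to ≋-trans)
module ≋-Reasoning = SetoidReasoning (ℕ →-setoid ℤ)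

infixl 6 _⊕_ _⊖_
infixr 7 _·_

_⊕_ _⊖_ : Series → Series → Series
(f ⊕ g) n = f n + g n
(f ⊖ g) n = f n - g n

_·_ : ℤ → Series → Series
(c · f) n = c * f n

tail : Series → Series
tail f n = f (suc n)

shift : ℕ → Series → Series
shift zero    f n       = f n
shift (suc m) f zero    = + 0
shift (suc m) f (suc n) = shift m f n

⊕-cong : ∀ {f f′ g g′} → f ≋ f′ → g ≋ g′ → (f ⊕ g) ≋ (f′ ⊕ g′)
⊕-cong p q n = cong₂ _+_ (p n) (q n)

⊖-cong : ∀ {f f′ g g′} → f ≋ f′ → g ≋ g′ → (f ⊖ g) ≋ (f′ ⊖ g′)
⊖-cong p q n = cong₂ _-_ (p n) (q n)

shift-cong : ∀ m {f g} → f ≋ g → shift m f ≋ shift m g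
shift-cong zero    p n       = p n
shift-cong (suc m) p zero    = refl
shift-cong (suc m) p (suc n) = shift-cong m p n

shift-zeroS : ∀ m → shift m zeroS ≋ zeroS
shift-zeroS zero    n       = refl
shift-zeroS (suc m) zero    = refl
shift-zeroS (suc m) (suc n) = shift-zeroS m n

shift-⊖ : ∀ m f g → shift m (f ⊖ g) ≋ (shift m f ⊖ shift m g)
shift-⊖ zero    f g n       = refl
shift-⊖ (suc m) f g zero    = refl
shift-⊖ (suc m) f g (suc n) = shift-⊖ m f g n

shift-shift : ∀ a b f → shift a (shift b f) ≋ shift (a ℕ.+ b) f
shift-shift zero    b f n       = refl
shift-shift (suc a) b f zero    = refl
shift-shift (suc a) b f (suc n) = shift-shift a b f n

shift-≥ : ∀ {s k} f → s ≤ k → shift s f k ≡ f (k ∸ s)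
shift-≥ {zero}          f _         = refl
shift-≥ {suc s} {suc k} f (s≤s s≤k) = shift-≥ f s≤k

shift-< : ∀ {s k} f → ¬ s ≤ k → shift s f k ≡ + 0
shift-< {zero}          f s≰k = ⊥-elim (s≰k z≤n)
shift-< {suc s} {zero}  f _   = refl
shift-< {suc s} {suc k} f s≰k = shift-< f (s≰k ∘ s≤s)

shift-one : ∀ m n → shift m one n ≡ (if n ≡ᵇ m then + 1 else + 0)
shift-one zero    zero    = refl
shift-one zero    (suc n) = refl
shift-one (suc m) zero    = refl
shift-one (suc m) (suc n) = shift-one m n

oneMinusQ^-≋ : ∀ m → oneMinusQ^ (suc m) ≋ (one ⊖ shift (suc m) one)
oneMinusQ^-≋ m zero = refl
oneMinusQ^-≋ m (suc n) rewrite shift-one m n with n ≡ᵇ m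
... | true  = refl
... | false = refl

⊛-constant : ∀ f g → (f ⊛ g) 0 ≡ f 0 * g 0
⊛-constant f g = ℤ.+-identityʳ (f 0 * g 0)

⊛-suc : ∀ f g n → (f ⊛ g) (suc n) ≡ f 0 * g (suc n) + (tail f ⊛ g) n
⊛-suc f g n = cong (λ xs → f 0 * g (suc n) + sumℤ xs)
  (trans (map-applyUpTo suc term (suc n)) (sym (map-upTo (term ∘ suc) (suc n))))
  where
  term : ℕ → ℤ
  term i = f i * g (suc n ∸ i)

⊛-sucʳ : ∀ f g n → (f ⊛ g) (suc n) ≡ f (suc n) * g 0 + (f ⊛ tail g) n
⊛-sucʳ f g zero = begin
  (f ⊛ g) 1                   ≡⟨ ⊛-suc f g 0 ⟩
  f 0 * g 1 + (tail f ⊛ g) 0  ≡⟨ cong₂ _+_ (ℤ.*-comm (f 0) (g 1)) (⊛-constant (tail f) g) ⟩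
  g 1 * f 0 + f 1 * g 0       ≡⟨ ℤ.+-comm (g 1 * f 0) (f 1 * g 0) ⟩
  f 1 * g 0 + g 1 * f 0       ≡⟨ cong (_+_ (f 1 * g 0)) (ℤ.*-comm (g 1) (f 0)) ⟩
  f 1 * g 0 + f 0 * g 1       ≡⟨ cong (_+_ (f 1 * g 0)) (⊛-constant f (tail g)) ⟨
  f 1 * g 0 + (f ⊛ tail g) 0  ∎
  where open ≡-Reasoning
⊛-sucʳ f g (suc n) = begin
  (f ⊛ g) (suc (suc n))                         ≡⟨ ⊛-suc f g (suc n) ⟩
  x + (tail f ⊛ g) (suc n)                      ≡⟨ cong (_+_ x) (⊛-sucʳ (tail f) g n) ⟩
  x + (y + (tail f ⊛ tail g) n)                 ≡⟨ swap x y ((tail f ⊛ tail g) n) ⟩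
  y + (x + (tail f ⊛ tail g) n)                 ≡⟨ cong (_+_ y) (⊛-suc f (tail g) n) ⟨
  y + (f ⊛ tail g) (suc n)                      ∎
  where
  open ≡-Reasoning
  x y : ℤ
  x = f 0 * g (suc (suc n))
  y = f (suc (suc n)) * g 0
  swap : ∀ x y z → x + (y + z) ≡ y + (x + z)
  swap = solve-∀

⊛-cong : ∀ {f f′ g g′} → f ≋ f′ → g ≋ g′ → (f ⊛ g) ≋ (f′ ⊛ g′)
⊛-cong p q n = cong sumℤ (map-cong (λ i → cong₂ _*_ (p i) (q (n ∸ i))) (upTo (suc n)))

⊛-comm : ∀ f g → (f ⊛ g) ≋ (g ⊛ f)
⊛-comm f g zero =
  trans (⊛-constant f g) (trans (ℤ.*-comm (f 0) (g 0)) (sym (⊛-constant g f)))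
⊛-comm f g (suc n) = begin
  (f ⊛ g) (suc n)                   ≡⟨ ⊛-suc f g n ⟩
  f 0 * g (suc n) + (tail f ⊛ g) n  ≡⟨ cong₂ _+_ (ℤ.*-comm (f 0) (g (suc n))) (⊛-comm (tail f) g n) ⟩
  g (suc n) * f 0 + (g ⊛ tail f) n  ≡⟨ ⊛-sucʳ g f n ⟨
  (g ⊛ f) (suc n)                   ∎
  where open ≡-Reasoning

⊛-zeroˡ : ∀ g → (zeroS ⊛ g) ≋ zeroS
⊛-zeroˡ g zero    = trans (⊛-constant zeroS g) (ℤ.*-zeroˡ (g 0))
⊛-zeroˡ g (suc n) = trans (⊛-suc zeroS g n) (cong₂ _+_ (ℤ.*-zeroˡ (g (suc n))) (⊛-zeroˡ g n))

⊛-identityˡ : ∀ g → (one ⊛ g) ≋ g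
⊛-identityˡ g zero    = trans (⊛-constant one g) (ℤ.*-identityˡ (g 0))
⊛-identityˡ g (suc n) = begin
  (one ⊛ g) (suc n)                ≡⟨ ⊛-suc one g n ⟩
  + 1 * g (suc n) + (zeroS ⊛ g) n  ≡⟨ cong₂ _+_ (ℤ.*-identityˡ (g (suc n))) (⊛-zeroˡ g n) ⟩
  g (suc n) + + 0                  ≡⟨ ℤ.+-identityʳ (g (suc n)) ⟩
  g (suc n)                        ∎
  where open ≡-Reasoning

⊛-identityʳ : ∀ f → (f ⊛ one) ≋ f
⊛-identityʳ f = ≋-trans (⊛-comm f one) (⊛-identityˡ f)

⊛-distribˡ-⊕ : ∀ h a b → (h ⊛ (a ⊕ b)) ≋ ((h ⊛ a) ⊕ (h ⊛ b))
⊛-distribˡ-⊕ h a b zero = begin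
  (h ⊛ (a ⊕ b)) 0        ≡⟨ ⊛-constant h (a ⊕ b) ⟩
  h 0 * (a 0 + b 0)      ≡⟨ ℤ.*-distribˡ-+ (h 0) (a 0) (b 0) ⟩
  h 0 * a 0 + h 0 * b 0  ≡⟨ cong₂ _+_ (⊛-constant h a) (⊛-constant h b) ⟨
  (h ⊛ a) 0 + (h ⊛ b) 0  ∎
  where open ≡-Reasoning
⊛-distribˡ-⊕ h a b (suc n) = begin
  (h ⊛ (a ⊕ b)) (suc n)
    ≡⟨ ⊛-suc h (a ⊕ b) n ⟩
  x * (y + z) + (tail h ⊛ (a ⊕ b)) n
    ≡⟨ cong (_+_ (x * (y + z))) (⊛-distribˡ-⊕ (tail h) a b n) ⟩
  x * (y + z) + ((tail h ⊛ a) n + (tail h ⊛ b) n)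
    ≡⟨ regroup x y z ((tail h ⊛ a) n) ((tail h ⊛ b) n) ⟩
  (x * y + (tail h ⊛ a) n) + (x * z + (tail h ⊛ b) n)
    ≡⟨ cong₂ _+_ (⊛-suc h a n) (⊛-suc h b n) ⟨
  (h ⊛ a) (suc n) + (h ⊛ b) (suc n)
    ∎
  where
  open ≡-Reasoning
  x y z : ℤ
  x = h 0
  y = a (suc n)
  z = b (suc n)
  regroup : ∀ x y z u v → x * (y + z) + (u + v) ≡ (x * y + u) + (x * z + v)
  regroup = solve-∀

⊛-distribʳ-⊕ : ∀ a b h → ((a ⊕ b) ⊛ h) ≋ ((a ⊛ h) ⊕ (b ⊛ h))
⊛-distribʳ-⊕ a b h = begin
  (a ⊕ b) ⊛ h              ≈⟨ ⊛-comm (a ⊕ b) h ⟩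
  h ⊛ (a ⊕ b)              ≈⟨ ⊛-distribˡ-⊕ h a b ⟩
  (h ⊛ a) ⊕ (h ⊛ b)        ≈⟨ ⊕-cong (⊛-comm h a) (⊛-comm h b) ⟩
  (a ⊛ h) ⊕ (b ⊛ h)        ∎
  where open ≋-Reasoning

⊛-distribˡ-⊖ : ∀ h a b → (h ⊛ (a ⊖ b)) ≋ ((h ⊛ a) ⊖ (h ⊛ b))
⊛-distribˡ-⊖ h a b n = x+y≡z⇒x≡z-y (begin
  (h ⊛ (a ⊖ b)) n + (h ⊛ b) n  ≡⟨ ⊛-distribˡ-⊕ h (a ⊖ b) b n ⟨
  (h ⊛ ((a ⊖ b) ⊕ b)) n        ≡⟨ ⊛-cong (≋-refl {h}) (λ i → [x-y]+y≡x (a i) (b i)) n ⟩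
  (h ⊛ a) n                    ∎)
  where
  open ≡-Reasoning
  [x-y]+y≡x : ∀ x y → x - y + y ≡ x
  [x-y]+y≡x = solve-∀
  x≡x+y-y : ∀ x y → x ≡ x + y - y
  x≡x+y-y = solve-∀
  x+y≡z⇒x≡z-y : ∀ {x y z} → x + y ≡ z → x ≡ z - y
  x+y≡z⇒x≡z-y {x} {y} refl = x≡x+y-y x y

⊛-scaleˡ : ∀ c a h → ((c · a) ⊛ h) ≋ (c · (a ⊛ h))
⊛-scaleˡ c a h zero = begin
  ((c · a) ⊛ h) 0  ≡⟨ ⊛-constant (c · a) h ⟩
  c * a 0 * h 0    ≡⟨ ℤ.*-assoc c (a 0) (h 0) ⟩
  c * (a 0 * h 0)  ≡⟨ cong (c *_) (⊛-constant a h) ⟨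
  c * (a ⊛ h) 0    ∎
  where open ≡-Reasoning
⊛-scaleˡ c a h (suc n) = begin
  ((c · a) ⊛ h) (suc n)                       ≡⟨ ⊛-suc (c · a) h n ⟩
  c * x * y + ((c · tail a) ⊛ h) n            ≡⟨ cong (_+_ (c * x * y)) (⊛-scaleˡ c (tail a) h n) ⟩
  c * x * y + c * (tail a ⊛ h) n              ≡⟨ factor c x y ((tail a ⊛ h) n) ⟩
  c * (x * y + (tail a ⊛ h) n)                ≡⟨ cong (c *_) (⊛-suc a h n) ⟨
  c * (a ⊛ h) (suc n)                         ∎
  where
  open ≡-Reasoning
  x y : ℤ
  x = a 0
  y = h (suc n)
  factor : ∀ c x y z → c * x * y + c * z ≡ c * (x * y + z)
  factor = solve-∀

⊛-assoc : ∀ f g h → ((f ⊛ g) ⊛ h) ≋ (f ⊛ (g ⊛ h))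
⊛-assoc f g h zero = begin
  ((f ⊛ g) ⊛ h) 0    ≡⟨ ⊛-constant (f ⊛ g) h ⟩
  (f ⊛ g) 0 * h 0    ≡⟨ cong (_* h 0) (⊛-constant f g) ⟩
  f 0 * g 0 * h 0    ≡⟨ ℤ.*-assoc (f 0) (g 0) (h 0) ⟩
  f 0 * (g 0 * h 0)  ≡⟨ cong (f 0 *_) (⊛-constant g h) ⟨
  f 0 * (g ⊛ h) 0    ≡⟨ ⊛-constant f (g ⊛ h) ⟨
  (f ⊛ (g ⊛ h)) 0    ∎
  where open ≡-Reasoning
⊛-assoc f g h (suc n) = begin
  ((f ⊛ g) ⊛ h) (suc n)
    ≡⟨ ⊛-suc (f ⊛ g) h n ⟩
  (f ⊛ g) 0 * y + (tail (f ⊛ g) ⊛ h) n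
    ≡⟨ cong₂ _+_ (cong (_* y) (⊛-constant f g)) (⊛-cong (⊛-suc f g) (≋-refl {h}) n) ⟩
  x * g 0 * y + (((x · tail g) ⊕ (tail f ⊛ g)) ⊛ h) n
    ≡⟨ cong (_+_ (x * g 0 * y)) (⊛-distribʳ-⊕ (x · tail g) (tail f ⊛ g) h n) ⟩
  x * g 0 * y + (((x · tail g) ⊛ h) n + ((tail f ⊛ g) ⊛ h) n)
    ≡⟨ cong (_+_ (x * g 0 * y)) (cong₂ _+_ (⊛-scaleˡ x (tail g) h n) (⊛-assoc (tail f) g h n)) ⟩
  x * g 0 * y + (x * (tail g ⊛ h) n + (tail f ⊛ (g ⊛ h)) n)
    ≡⟨ factor x (g 0) y ((tail g ⊛ h) n) ((tail f ⊛ (g ⊛ h)) n) ⟩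
  x * (g 0 * y + (tail g ⊛ h) n) + (tail f ⊛ (g ⊛ h)) n
    ≡⟨ cong (λ z → x * z + (tail f ⊛ (g ⊛ h)) n) (⊛-suc g h n) ⟨
  x * (g ⊛ h) (suc n) + (tail f ⊛ (g ⊛ h)) n
    ≡⟨ ⊛-suc f (g ⊛ h) n ⟨
  (f ⊛ (g ⊛ h)) (suc n)
    ∎
  where
  open ≡-Reasoning
  x y : ℤ
  x = f 0
  y = h (suc n)
  factor : ∀ a b c d e → a * b * c + (a * d + e) ≡ a * (b * c + d) + e
  factor = solve-∀

⊛-swapʳ : ∀ f g h → ((f ⊛ g) ⊛ h) ≋ ((f ⊛ h) ⊛ g)
⊛-swapʳ f g h = begin
  (f ⊛ g) ⊛ h  ≈⟨ ⊛-assoc f g h ⟩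
  f ⊛ (g ⊛ h)  ≈⟨ ⊛-cong (≋-refl {f}) (⊛-comm g h) ⟩
  f ⊛ (h ⊛ g)  ≈⟨ ⊛-assoc f h g ⟨
  (f ⊛ h) ⊛ g  ∎
  where open ≋-Reasoning

shift-one-⊛ : ∀ m g → (shift m one ⊛ g) ≋ shift m g
shift-one-⊛ zero    g n       = ⊛-identityˡ g n
shift-one-⊛ (suc m) g zero    = trans (⊛-constant (shift (suc m) one) g) (ℤ.*-zeroˡ (g 0))
shift-one-⊛ (suc m) g (suc n) = begin
  (shift (suc m) one ⊛ g) (suc n)        ≡⟨ ⊛-suc (shift (suc m) one) g n ⟩
  + 0 * g (suc n) + (shift m one ⊛ g) n  ≡⟨ cong₂ _+_ (ℤ.*-zeroˡ (g (suc n))) (shift-one-⊛ m g n) ⟩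
  + 0 + shift m g n                      ≡⟨ ℤ.+-identityˡ (shift m g n) ⟩
  shift m g n                            ∎
  where open ≡-Reasoning

⊛-shiftʳ : ∀ m f g → (f ⊛ shift m g) ≋ shift m (f ⊛ g)
⊛-shiftʳ m f g = begin
  f ⊛ shift m g          ≈⟨ ⊛-cong (≋-refl {f}) (shift-one-⊛ m g) ⟨
  f ⊛ (shift m one ⊛ g)  ≈⟨ ⊛-assoc f (shift m one) g ⟨
  (f ⊛ shift m one) ⊛ g  ≈⟨ ⊛-cong (⊛-comm f (shift m one)) (≋-refl {g}) ⟩
  (shift m one ⊛ f) ⊛ g  ≈⟨ ⊛-assoc (shift m one) f g ⟩
  shift m one ⊛ (f ⊛ g)  ≈⟨ shift-one-⊛ m (f ⊛ g) ⟩
  shift m (f ⊛ g)        ∎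
  where open ≋-Reasoning

⊛-oneMinusQ^ : ∀ m f → (f ⊛ oneMinusQ^ (suc m)) ≋ (f ⊖ shift (suc m) f)
⊛-oneMinusQ^ m f = begin
  f ⊛ oneMinusQ^ (suc m)               ≈⟨ ⊛-cong (≋-refl {f}) (oneMinusQ^-≋ m) ⟩
  f ⊛ (one ⊖ shift (suc m) one)        ≈⟨ ⊛-distribˡ-⊖ f one (shift (suc m) one) ⟩
  (f ⊛ one) ⊖ (f ⊛ shift (suc m) one)  ≈⟨ ⊖-cong (⊛-identityʳ f) (⊛-shiftʳ (suc m) f one) ⟩
  f ⊖ shift (suc m) (f ⊛ one)          ≈⟨ ⊖-cong (≋-refl {f}) (shift-cong (suc m) (⊛-identityʳ f)) ⟩
  f ⊖ shift (suc m) f                  ∎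
  where open ≋-Reasoning

invPrefix-applyUpTo : ∀ a n → invPrefix a n ≡ applyUpTo (λ i → inv a (n ∸ i)) (suc n)
invPrefix-applyUpTo a zero    = refl
invPrefix-applyUpTo a (suc n) = cong (inv a (suc n) ∷_) (invPrefix-applyUpTo a n)

zipWith-applyUpTo : ∀ (_∙_ : ℤ → ℤ → ℤ) f g n →
  zipWith _∙_ (applyUpTo f n) (applyUpTo g n) ≡ applyUpTo (λ i → f i ∙ g i) n
zipWith-applyUpTo _∙_ f g zero    = refl
zipWith-applyUpTo _∙_ f g (suc n) =
  cong (f 0 ∙ g 0 ∷_) (zipWith-applyUpTo _∙_ (f ∘ suc) (g ∘ suc) n)

inv-suc : ∀ a n → inv a (suc n) ≡ - (tail a ⊛ inv a) n
inv-suc a n = cong (λ xs → - sumℤ xs) (begin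
  zipWith _*_ (map (tail a) (upTo (suc n))) (invPrefix a n)
    ≡⟨ cong₂ (zipWith _*_) (map-upTo (tail a) (suc n)) (invPrefix-applyUpTo a n) ⟩
  zipWith _*_ (applyUpTo (tail a) (suc n)) (applyUpTo (λ i → inv a (n ∸ i)) (suc n))
    ≡⟨ zipWith-applyUpTo _*_ (tail a) (λ i → inv a (n ∸ i)) (suc n) ⟩
  applyUpTo (λ i → a (suc i) * inv a (n ∸ i)) (suc n)
    ≡⟨ map-upTo (λ i → a (suc i) * inv a (n ∸ i)) (suc n) ⟨
  map (λ i → a (suc i) * inv a (n ∸ i)) (upTo (suc n))
    ∎)
  where open ≡-Reasoning

⊛-inverseʳ : ∀ a → a 0 ≡ + 1 → (a ⊛ inv a) ≋ one
⊛-inverseʳ a a₀≡1 zero    = trans (⊛-constant a (inv a)) (cong (_* + 1) a₀≡1)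
⊛-inverseʳ a a₀≡1 (suc n) = begin
  (a ⊛ inv a) (suc n)              ≡⟨ ⊛-suc a (inv a) n ⟩
  a 0 * inv a (suc n) + x          ≡⟨ cong₂ (λ c y → c * y + x) a₀≡1 (inv-suc a n) ⟩
  + 1 * - x + x                    ≡⟨ cancel x ⟩
  + 0                              ∎
  where
  open ≡-Reasoning
  x : ℤ
  x = (tail a ⊛ inv a) n
  cancel : ∀ x → + 1 * - x + x ≡ + 0
  cancel = solve-∀

inv-unique : ∀ a b → a 0 ≡ + 1 → (b ⊛ a) ≋ one → b ≋ inv a
inv-unique a b a₀≡1 ba≋1 = begin
  b                ≈⟨ ⊛-identityʳ b ⟨
  b ⊛ one          ≈⟨ ⊛-cong (≋-refl {b}) (⊛-inverseʳ a a₀≡1) ⟨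
  b ⊛ (a ⊛ inv a)  ≈⟨ ⊛-assoc b a (inv a) ⟨
  (b ⊛ a) ⊛ inv a  ≈⟨ ⊛-cong ba≋1 (≋-refl {inv a}) ⟩
  one ⊛ inv a      ≈⟨ ⊛-identityˡ (inv a) ⟩
  inv a            ∎
  where open ≋-Reasoning

qPoch-constant : ∀ l → qPoch l 0 ≡ + 1
qPoch-constant zero    = refl
qPoch-constant (suc l) =
  trans (⊛-constant (qPoch l) (oneMinusQ^ (suc l))) (cong (_* + 1) (qPoch-constant l))

qPoch⁻¹ : ℕ → Series
qPoch⁻¹ n = inv (qPoch n)

qPoch-⊛-qPoch⁻¹ : ∀ n → (qPoch n ⊛ qPoch⁻¹ n) ≋ one
qPoch-⊛-qPoch⁻¹ n = ⊛-inverseʳ (qPoch n) (qPoch-constant n)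

qPoch⁻¹-zero : qPoch⁻¹ 0 ≋ one
qPoch⁻¹-zero = ≋-sym (inv-unique one one refl (⊛-identityˡ one))

qPoch⁻¹-⊛-oneMinusQ^ : ∀ n → (qPoch⁻¹ (suc n) ⊛ oneMinusQ^ (suc n)) ≋ qPoch⁻¹ n
qPoch⁻¹-⊛-oneMinusQ^ n = inv-unique (qPoch n) (I ⊛ oneMinusQ^ (suc n)) (qPoch-constant n) (begin
  (I ⊛ oneMinusQ^ (suc n)) ⊛ qPoch n  ≈⟨ ⊛-assoc I (oneMinusQ^ (suc n)) (qPoch n) ⟩
  I ⊛ (oneMinusQ^ (suc n) ⊛ qPoch n)  ≈⟨ ⊛-cong (≋-refl {I}) (⊛-comm (oneMinusQ^ (suc n)) (qPoch n)) ⟩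
  I ⊛ qPoch (suc n)                   ≈⟨ ⊛-comm I (qPoch (suc n)) ⟩
  qPoch (suc n) ⊛ I                   ≈⟨ qPoch-⊛-qPoch⁻¹ (suc n) ⟩
  one                                 ∎)
  where
  open ≋-Reasoning
  I : Series
  I = qPoch⁻¹ (suc n)

qPoch⁻¹-suc : ∀ n → qPoch⁻¹ (suc n) ≋ (qPoch⁻¹ n ⊕ shift (suc n) (qPoch⁻¹ (suc n)))
qPoch⁻¹-suc n k =
  x-y≡z⇒x≡z+y (trans (sym (⊛-oneMinusQ^ n (qPoch⁻¹ (suc n)) k)) (qPoch⁻¹-⊛-oneMinusQ^ n k))
  where
  x≡x-y+y : ∀ x y → x ≡ x - y + y
  x≡x-y+y = solve-∀
  x-y≡z⇒x≡z+y : ∀ {x y z} → x - y ≡ z → x ≡ z + y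
  x-y≡z⇒x≡z+y {x} {y} refl = x≡x-y+y x y

qPoch⁻¹-⊛-suc : ∀ j m → (qPoch⁻¹ j ⊛ qPoch⁻¹ (suc m)) ≋
  ((qPoch⁻¹ j ⊛ qPoch⁻¹ m) ⊕ shift (suc m) (qPoch⁻¹ (suc m) ⊛ qPoch⁻¹ j))
qPoch⁻¹-⊛-suc j m = begin
  I j ⊛ I (suc m)                           ≈⟨ ⊛-cong (≋-refl {I j}) (qPoch⁻¹-suc m) ⟩
  I j ⊛ (I m ⊕ shift (suc m) (I (suc m)))   ≈⟨ ⊛-distribˡ-⊕ (I j) (I m) (shift (suc m) (I (suc m))) ⟩
  (I j ⊛ I m) ⊕ (I j ⊛ shift (suc m) (I (suc m)))
    ≈⟨ ⊕-cong (≋-refl {I j ⊛ I m}) (⊛-shiftʳ (suc m) (I j) (I (suc m))) ⟩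
  (I j ⊛ I m) ⊕ shift (suc m) (I j ⊛ I (suc m))
    ≈⟨ ⊕-cong (≋-refl {I j ⊛ I m}) (shift-cong (suc m) (⊛-comm (I j) (I (suc m)))) ⟩
  (I j ⊛ I m) ⊕ shift (suc m) (I (suc m) ⊛ I j)
    ∎
  where
  open ≋-Reasoning
  I : ℕ → Series
  I = qPoch⁻¹

gaussian : ℕ → ℕ → ℕ → Series
gaussian N a b = (qPoch N ⊛ qPoch⁻¹ a) ⊛ qPoch⁻¹ b

gaussian-diag : ∀ n → gaussian n n 0 ≋ one
gaussian-diag n = begin
  (qPoch n ⊛ qPoch⁻¹ n) ⊛ qPoch⁻¹ 0  ≈⟨ ⊛-cong (qPoch-⊛-qPoch⁻¹ n) qPoch⁻¹-zero ⟩
  one ⊛ one                          ≈⟨ ⊛-identityˡ one ⟩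
  one                                ∎
  where open ≋-Reasoning

gaussian-comm : ∀ N a b → gaussian N a b ≋ gaussian N b a
gaussian-comm N a b = ⊛-swapʳ (qPoch N) (qPoch⁻¹ a) (qPoch⁻¹ b)

gaussian-suc : ∀ N a b → gaussian (suc N) a b ≋ (gaussian N a b ⊛ oneMinusQ^ (suc N))
gaussian-suc N a b = begin
  ((qPoch N ⊛ oneMinusQ^ (suc N)) ⊛ qPoch⁻¹ a) ⊛ qPoch⁻¹ b
    ≈⟨ ⊛-cong (⊛-swapʳ (qPoch N) (oneMinusQ^ (suc N)) (qPoch⁻¹ a)) (≋-refl {qPoch⁻¹ b}) ⟩
  ((qPoch N ⊛ qPoch⁻¹ a) ⊛ oneMinusQ^ (suc N)) ⊛ qPoch⁻¹ b
    ≈⟨ ⊛-swapʳ (qPoch N ⊛ qPoch⁻¹ a) (oneMinusQ^ (suc N)) (qPoch⁻¹ b) ⟩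
  gaussian N a b ⊛ oneMinusQ^ (suc N)
    ∎
  where open ≋-Reasoning

gaussian-pred : ∀ N a b → gaussian N a b ≋ (gaussian N a (suc b) ⊛ oneMinusQ^ (suc b))
gaussian-pred N a b = begin
  (qPoch N ⊛ qPoch⁻¹ a) ⊛ qPoch⁻¹ b
    ≈⟨ ⊛-cong (≋-refl {qPoch N ⊛ qPoch⁻¹ a}) (qPoch⁻¹-⊛-oneMinusQ^ b) ⟨
  (qPoch N ⊛ qPoch⁻¹ a) ⊛ (qPoch⁻¹ (suc b) ⊛ oneMinusQ^ (suc b))
    ≈⟨ ⊛-assoc (qPoch N ⊛ qPoch⁻¹ a) (qPoch⁻¹ (suc b)) (oneMinusQ^ (suc b)) ⟨
  gaussian N a (suc b) ⊛ oneMinusQ^ (suc b)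
    ∎
  where open ≋-Reasoning

-- All three gaussians are W (1 − q^t) for W = gaussian N (a+1) (b+1) and t = N+1, b+1, a+1.
gaussian-pascal : ∀ N a b → suc N ≡ suc a ℕ.+ suc b →
  gaussian (suc N) (suc a) (suc b) ≋ (gaussian N (suc a) b ⊕ shift (suc b) (gaussian N (suc b) a))
gaussian-pascal N a b e = begin
  gaussian (suc N) (suc a) (suc b)  ≈⟨ gaussian-suc N (suc a) (suc b) ⟩
  W ⊛ oneMinusQ^ (suc N)            ≈⟨ ⊛-oneMinusQ^ N W ⟩
  W ⊖ shift (suc N) W               ≈⟨ telescope ⟩
  (W ⊖ shift (suc b) W) ⊕ (shift (suc b) W ⊖ shift (suc N) W)
    ≈⟨ ⊕-cong (≋-sym (≋-trans (gaussian-pred N (suc a) b) (⊛-oneMinusQ^ b W))) (≋-sym shifted) ⟩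
  gaussian N (suc a) b ⊕ shift (suc b) (gaussian N (suc b) a)
    ∎
  where
  open ≋-Reasoning
  W : Series
  W = gaussian N (suc a) (suc b)
  telescope : (W ⊖ shift (suc N) W) ≋ ((W ⊖ shift (suc b) W) ⊕ (shift (suc b) W ⊖ shift (suc N) W))
  telescope n = split (W n) (shift (suc b) W n) (shift (suc N) W n)
    where
    split : ∀ x y z → x - z ≡ (x - y) + (y - z)
    split = solve-∀
  other : gaussian N (suc b) a ≋ (W ⊖ shift (suc a) W)
  other = begin
    gaussian N (suc b) a                             ≈⟨ gaussian-pred N (suc b) a ⟩
    gaussian N (suc b) (suc a) ⊛ oneMinusQ^ (suc a)
      ≈⟨ ⊛-cong (gaussian-comm N (suc b) (suc a)) (≋-refl {oneMinusQ^ (suc a)}) ⟩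
    W ⊛ oneMinusQ^ (suc a)                           ≈⟨ ⊛-oneMinusQ^ a W ⟩
    W ⊖ shift (suc a) W                              ∎
  shifted : shift (suc b) (gaussian N (suc b) a) ≋ (shift (suc b) W ⊖ shift (suc N) W)
  shifted = begin
    shift (suc b) (gaussian N (suc b) a)               ≈⟨ shift-cong (suc b) other ⟩
    shift (suc b) (W ⊖ shift (suc a) W)                ≈⟨ shift-⊖ (suc b) W (shift (suc a) W) ⟩
    shift (suc b) W ⊖ shift (suc b) (shift (suc a) W)
      ≈⟨ ⊖-cong (≋-refl {shift (suc b) W}) (shift-shift (suc b) (suc a) W) ⟩
    shift (suc b) W ⊖ shift (suc b ℕ.+ suc a) W
      ≡⟨ cong (λ t → shift (suc b) W ⊖ shift t W) (trans (+-comm (suc b) (suc a)) (sym e)) ⟩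
    shift (suc b) W ⊖ shift (suc N) W                  ∎

qBinom-gaussian : ∀ {N} j m → N ≡ j ℕ.+ m → qBinom N j ≋ gaussian N j m
qBinom-gaussian j m refl n with j ≤ᵇ j ℕ.+ m | ≤⇒≤ᵇ (m≤m+n j m)
... | true | _ = cong (λ t → gaussian (j ℕ.+ m) j t n) (m+n∸m≡n j m)

qBinom-above : ∀ N j → N < j → qBinom N j ≋ zeroS
qBinom-above N j N<j n with j ≤ᵇ N | ≤ᵇ⇒≤ j N
... | false | _   = refl
... | true  | j≤N = ⊥-elim (<⇒≱ N<j (j≤N _))

qBinom-zero : ∀ n → qBinom n 0 ≋ one
qBinom-zero n = ≋-trans (qBinom-gaussian 0 n refl) (≋-trans (gaussian-comm n 0 n) (gaussian-diag n))

qBinom-diag : ∀ n → qBinom n n ≋ one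
qBinom-diag n = ≋-trans (qBinom-gaussian n 0 (sym (+-identityʳ n))) (gaussian-diag n)

qBinom-pascal : ∀ {N j s} → suc N ≡ j ℕ.+ s →
  qBinom (suc N) j ≋ (qBinom N j ⊕ shift s (qBinom N s))
qBinom-pascal {N} {zero} {suc N} refl = begin
  qBinom (suc N) 0                               ≈⟨ qBinom-zero (suc N) ⟩
  one                                            ≈⟨ (λ n → sym (ℤ.+-identityʳ (one n))) ⟩
  one ⊕ zeroS                                    ≈⟨ ⊕-cong (qBinom-zero N) (shift-zeroS (suc N)) ⟨
  qBinom N 0 ⊕ shift (suc N) zeroS
    ≈⟨ ⊕-cong (≋-refl {qBinom N 0}) (shift-cong (suc N) (qBinom-above N (suc N) ≤-refl)) ⟨
  qBinom N 0 ⊕ shift (suc N) (qBinom N (suc N))  ∎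
  where open ≋-Reasoning
qBinom-pascal {N} {suc j} {zero} e with suc-injective (trans e (+-identityʳ (suc j)))
... | refl = begin
  qBinom (suc N) (suc N)         ≈⟨ qBinom-diag (suc N) ⟩
  one                            ≈⟨ (λ n → sym (ℤ.+-identityˡ (one n))) ⟩
  zeroS ⊕ one                    ≈⟨ ⊕-cong (qBinom-above N (suc N) ≤-refl) (qBinom-zero N) ⟨
  qBinom N (suc N) ⊕ qBinom N 0  ∎
  where open ≋-Reasoning
qBinom-pascal {N} {suc a} {suc b} e = begin
  qBinom (suc N) (suc a)                                       ≈⟨ qBinom-gaussian (suc a) (suc b) e ⟩
  gaussian (suc N) (suc a) (suc b)                             ≈⟨ gaussian-pascal N a b e ⟩
  gaussian N (suc a) b ⊕ shift (suc b) (gaussian N (suc b) a)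
    ≈⟨ ⊕-cong (qBinom-gaussian (suc a) b N≡a+b) (shift-cong (suc b) (qBinom-gaussian (suc b) a N≡b+a)) ⟨
  qBinom N (suc a) ⊕ shift (suc b) (qBinom N (suc b))          ∎
  where
  open ≋-Reasoning
  N≡a+b : N ≡ suc a ℕ.+ b
  N≡a+b = suc-injective (trans e (cong suc (+-suc a b)))
  N≡b+a : N ≡ suc b ℕ.+ a
  N≡b+a = trans N≡a+b (cong suc (+-comm a b))

γ-∷ : ∀ a r → γ (a ∷ r) ≡ + a - γ r
γ-∷ a []      = sym (ℤ.+-identityʳ (+ a))
γ-∷ a (b ∷ r) = trans (regroup (+ a) (+ b) (γ r)) (cong (_-_ (+ a)) (sym (γ-∷ b r)))
  where
  regroup : ∀ x y z → x - y + z ≡ x - (y - z)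
  regroup = solve-∀

ℰ-∷ : ∀ a r → + ℰ (a ∷ r) ≡ γ r + + ℰ r
ℰ-∷ a []      = refl
ℰ-∷ a (b ∷ r) = trans (regroup (+ b) (γ r) (+ ℰ r)) (sym (cong₂ _+_ (γ-∷ b r) (ℰ-∷ b r)))
  where
  regroup : ∀ x y z → x + z ≡ (x - y) + (y + z)
  regroup = solve-∀

ℰ-∷-γ : ∀ a r {s} → γ r ≡ + s → ℰ (a ∷ r) ≡ s ℕ.+ ℰ r
ℰ-∷-γ a r γr≡s = ℤ.+-injective (trans (ℰ-∷ a r) (cong (_+ + ℰ r) γr≡s))

γ-∷-⇔ : ∀ {n j s} → n ≡ j ℕ.+ s → ∀ r → (γ (n ∷ r) ≡ + j) ⇔ (γ r ≡ + s)
γ-∷-⇔ {j = j} {s} refl r = mk⇔ peel attach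
  where
  open ≡-Reasoning
  n : ℤ
  n = + j + + s
  x≡n-[n-x] : ∀ x n → x ≡ n - (n - x)
  x≡n-[n-x] = solve-∀
  [x+y]-x≡y : ∀ x y → (x + y) - x ≡ y
  [x+y]-x≡y = solve-∀
  [x+y]-y≡x : ∀ x y → (x + y) - y ≡ x
  [x+y]-y≡x = solve-∀
  peel : γ ((j ℕ.+ s) ∷ r) ≡ + j → γ r ≡ + s
  peel γ≡j = begin
    γ r              ≡⟨ x≡n-[n-x] (γ r) n ⟩
    n - (n - γ r)    ≡⟨ cong (_-_ n) (trans (sym (γ-∷ (j ℕ.+ s) r)) γ≡j) ⟩
    n - + j          ≡⟨ [x+y]-x≡y (+ j) (+ s) ⟩
    + s              ∎
  attach : γ r ≡ + s → γ ((j ℕ.+ s) ∷ r) ≡ + j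
  attach γ≡s = begin
    γ ((j ℕ.+ s) ∷ r)  ≡⟨ γ-∷ (j ℕ.+ s) r ⟩
    n - γ r            ≡⟨ cong (_-_ n) γ≡s ⟩
    n - + s            ≡⟨ [x+y]-y≡x (+ j) (+ s) ⟩
    + j                ∎

γ-≤-head : ∀ {a r} → Linked _≥_ (a ∷ r) → Σ ℕ λ g → g ≤ a × γ (a ∷ r) ≡ + g
γ-≤-head {a} {[]}    _           = a , ≤-refl , refl
γ-≤-head {a} {b ∷ r} (b≤a ∷ lnk) with γ-≤-head lnk
... | g , g≤b , γ≡g = a ∸ g , m∸n≤m a g , (begin
  γ (a ∷ b ∷ r)      ≡⟨ γ-∷ a (b ∷ r) ⟩
  + a - γ (b ∷ r)    ≡⟨ cong (_-_ (+ a)) γ≡g ⟩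
  + a - + g          ≡⟨ ℤ.m-n≡m⊖n a g ⟩
  a Data.Integer.⊖ g ≡⟨ ℤ.⊖-≥ (≤-trans g≤b b≤a) ⟩
  + (a ∸ g)          ∎)
  where open ≡-Reasoning

γ-≤ : ∀ {N j π} → InP≤ N π → γ π ≡ + j → j ≤ N
γ-≤ {π = []}    _                     refl = z≤n
γ-≤ {π = a ∷ r} ((_ , lnk) , a≤N ∷ _) γ≡j with γ-≤-head lnk
... | g , g≤a , γ≡g = ≤-trans (subst (_≤ a) (ℤ.+-injective (trans (sym γ≡g) γ≡j)) g≤a) a≤N

record Count (S : Pred (List ℕ) 0ℓ) (F : Series) (k : ℕ) : Set where
  constructor enumerated
  field
    list    : List (List ℕ)
    unique  : Unique list
    members : ∀ π → (π ∈ list) ⇔ (S π × ℰ π ≡ k)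
    size    : + length list ≡ F k

genFun : ∀ {S F} → (∀ k → Count S F k) → GenFun S F
genFun count k = list , unique , members , size
  where open Count (count k)

infixr 7 _∷ᴾ_

_∷ᴾ_ : ℕ → Pred (List ℕ) 0ℓ → Pred (List ℕ) 0ℓ
(a ∷ᴾ S) π = Σ (List ℕ) λ r → π ≡ a ∷ r × S r

private
  variable
    k N : ℕ
    π r : List ℕ
    F G : Series
    S S′ : Pred (List ℕ) 0ℓ

count-resp : S ≐ S′ → F k ≡ G k → Count S F k → Count S′ G k
count-resp {S = S} {S′ = S′} {k = k} (S⊆S′ , S′⊆S) F≡G (enumerated L unique members size) =
  enumerated L unique members′ (trans size F≡G)
  where
  members′ : ∀ π → (π ∈ L) ⇔ (S′ π × ℰ π ≡ k)
  members′ π = mk⇔ (Product.map₁ S⊆S′ ∘ to (members π)) (from (members π) ∘ Product.map₁ S′⊆S)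

count-∅ : Empty S → Count S zeroS k
count-∅ S-empty = enumerated [] [] (λ π → mk⇔ (λ ()) (λ (Sπ , _) → ⊥-elim (S-empty π Sπ))) refl

count-[] : Count (_≡ []) one k
count-[] {zero}  = enumerated ([] ∷ []) ([] ∷ [])
  (λ π → mk⇔ (λ { (here refl) → refl , refl }) (λ { (refl , _) → here refl })) refl
count-[] {suc k} = enumerated [] [] (λ π → mk⇔ (λ ()) (λ { (refl , ()) })) refl

count-∪ : S ⊥ S′ → Count S F k → Count S′ G k → Count (S ∪ S′) (F ⊕ G) k
count-∪ {S = S} {S′ = S′} {k = k} disjoint
  (enumerated L unique members size) (enumerated L′ unique′ members′ size′) =
  enumerated (L ++ L′)
    (Unique.++⁺ unique unique′ (λ (π∈L , π∈L′) → disjoint (in-S π∈L , in-S′ π∈L′)))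
    (λ π → mk⇔ (split π) (merge π))
    (trans (cong +_ (length-++ L)) (cong₂ _+_ size size′))
  where
  in-S : ∀ {π} → π ∈ L → S π
  in-S π∈L = proj₁ (to (members _) π∈L)
  in-S′ : ∀ {π} → π ∈ L′ → S′ π
  in-S′ π∈L′ = proj₁ (to (members′ _) π∈L′)
  split : ∀ π → π ∈ L ++ L′ → (S ∪ S′) π × ℰ π ≡ k
  split π π∈ with ∈-++⁻ L π∈
  ... | inj₁ π∈L  = Product.map₁ inj₁ (to (members π) π∈L)
  ... | inj₂ π∈L′ = Product.map₁ inj₂ (to (members′ π) π∈L′)
  merge : ∀ π → (S ∪ S′) π × ℰ π ≡ k → π ∈ L ++ L′
  merge π (inj₁ Sπ , e)  = ∈-++⁺ˡ (from (members π) (Sπ , e))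
  merge π (inj₂ S′π , e) = ∈-++⁺ʳ L (from (members′ π) (S′π , e))

count-∷ᴾ : ∀ {a s} → (∀ {r} → S r → γ r ≡ + s) →
  (∀ {k′} → k ≡ s ℕ.+ k′ → Count S F k′) → Count (a ∷ᴾ S) (shift s F) k
count-∷ᴾ {S = S} {k = k} {F = F} {a} {s} γ≡s count with s ≤? k
... | no s≰k = enumerated [] [] (λ π → mk⇔ (λ ()) impossible) (sym (shift-< F s≰k))
  where
  impossible : ∀ {π} → (a ∷ᴾ S) π × ℰ π ≡ k → π ∈ []
  impossible ((r , refl , Sr) , e) =
    ⊥-elim (s≰k (subst (s ≤_) (trans (sym (ℰ-∷-γ a r (γ≡s Sr))) e) (m≤m+n s (ℰ r))))
... | yes s≤k with count (sym (m+[n∸m]≡n s≤k))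
...   | enumerated L unique members size =
  enumerated (map (a ∷_) L) (Unique.map⁺ ∷-injectiveʳ unique) (λ π → mk⇔ split merge)
    (trans (cong +_ (length-map (a ∷_) L)) (trans size (sym (shift-≥ F s≤k))))
  where
  split : ∀ {π} → π ∈ map (a ∷_) L → (a ∷ᴾ S) π × ℰ π ≡ k
  split π∈ with ∈-map⁻ (a ∷_) π∈
  ... | r , r∈L , refl with to (members r) r∈L
  ...   | Sr , e = (r , refl , Sr) ,
    trans (ℰ-∷-γ a r (γ≡s Sr)) (trans (cong (s ℕ.+_) e) (m+[n∸m]≡n s≤k))
  merge : ∀ {π} → (a ∷ᴾ S) π × ℰ π ≡ k → π ∈ map (a ∷_) L
  merge ((r , refl , Sr) , e) = ∈-map⁺ (a ∷_) (from (members r) (Sr , (begin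
    ℰ r                   ≡⟨ m+n∸m≡n s (ℰ r) ⟨
    s ℕ.+ ℰ r ∸ s         ≡⟨ cong (_∸ s) (trans (sym (ℰ-∷-γ a r (γ≡s Sr))) e) ⟩
    k ∸ s                 ∎)))
    where open ≡-Reasoning

bounded-by-head : ∀ {x r} → Linked _≥_ (x ∷ r) → x ≤ N → All (_≤ N) (x ∷ r)
bounded-by-head lnk x≤N =
  All.map (λ y≤x → ≤-trans y≤x x≤N) (Linked⇒All (Flip.transitive _≤_ ≤-trans) ≤-refl lnk)

strictly-below-head : Linked _>_ (suc N ∷ r) → All (_≤ N) r
strictly-below-head [-]          = []
strictly-below-head (1+N>y ∷ lnk) = All.map s≤s⁻¹ (Linked⇒All (Flip.transitive _<_ <-trans) 1+N>y lnk)

∷-linked : ∀ {R : ℕ → ℕ → Set} {x r} → All (R x) r → Linked R r → Linked R (x ∷ r)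
∷-linked []        _   = [-]
∷-linked (Rxy ∷ _) lnk = Rxy ∷ lnk

InP≤-weaken : InP≤ N π → InP≤ (suc N) π
InP≤-weaken (p , bnd) = p , All.map m≤n⇒m≤1+n bnd

InP≤-∷ : InP≤ (suc N) r → InP≤ (suc N) (suc N ∷ r)
InP≤-∷ ((pos , lnk) , bnd) = (s≤s z≤n ∷ pos , ∷-linked bnd lnk) , ≤-refl ∷ bnd

InP≤-split : InP≤ (suc N) π → InP≤ N π ⊎ (suc N ∷ᴾ InP≤ (suc N)) π
InP≤-split {π = []}    _                           = inj₁ (([] , []) , [])
InP≤-split {π = x ∷ r} ((pos , lnk) , x≤1+N ∷ bnd) with m≤n⇒m<n∨m≡n x≤1+N
... | inj₁ x<1+N = inj₁ ((pos , lnk) , bounded-by-head lnk (s≤s⁻¹ x<1+N))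
... | inj₂ refl  = inj₂ (r , refl , (All.tail pos , Linked.tail lnk) , bnd)

InP≤-zero : InP≤ 0 π → π ≡ []
InP≤-zero {π = []}    _                            = refl
InP≤-zero {π = x ∷ r} ((s≤s _ ∷ _ , _) , () ∷ _)

InD≤⇒InP≤ : InD≤ N π → InP≤ N π
InD≤⇒InP≤ ((p , _) , bnd) = p , bnd

InD≤-weaken : InD≤ N π → InD≤ (suc N) π
InD≤-weaken (d , bnd) = d , All.map m≤n⇒m≤1+n bnd

InD≤-∷ : InD≤ N r → InD≤ (suc N) (suc N ∷ r)
InD≤-∷ (((pos , lnk≥) , lnk>) , bnd) =
  ((s≤s z≤n ∷ pos , ∷-linked (All.map m≤n⇒m≤1+n bnd) lnk≥) , ∷-linked (All.map s≤s bnd) lnk>) ,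
  ≤-refl ∷ All.map m≤n⇒m≤1+n bnd

InD≤-split : InD≤ (suc N) π → InD≤ N π ⊎ (suc N ∷ᴾ InD≤ N) π
InD≤-split {π = []}    _                                     = inj₁ ((([] , []) , []) , [])
InD≤-split {π = x ∷ r} (((pos , lnk≥) , lnk>) , x≤1+N ∷ bnd) with m≤n⇒m<n∨m≡n x≤1+N
... | inj₁ x<1+N = inj₁ (((pos , lnk≥) , lnk>) , bounded-by-head lnk≥ (s≤s⁻¹ x<1+N))
... | inj₂ refl  = inj₂ (r , refl ,
  ((All.tail pos , Linked.tail lnk≥) , Linked.tail lnk>) , strictly-below-head lnk>)

𝒫 𝒟 : ℕ → ℕ → Pred (List ℕ) 0ℓ
𝒫 N j π = InP≤ N π × γ π ≡ + j
𝒟 N j π = InD≤ N π × γ π ≡ + j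

𝒫-zero : 𝒫 0 0 ≐ (_≡ [])
𝒫-zero = (λ (p , _) → InP≤-zero p) , λ { refl → (([] , []) , []) , refl }

𝒟-zero : 𝒟 0 0 ≐ (_≡ [])
𝒟-zero = (λ (d , _) → InP≤-zero (InD≤⇒InP≤ d)) , λ { refl → ((([] , []) , []) , []) , refl }

𝒫-empty : ∀ {N j} → N < j → Empty (𝒫 N j)
𝒫-empty N<j π (p , γ≡j) = <⇒≱ N<j (γ-≤ p γ≡j)

𝒟-empty : ∀ {N j} → N < j → Empty (𝒟 N j)
𝒟-empty N<j π (d , γ≡j) = 𝒫-empty N<j π (InD≤⇒InP≤ d , γ≡j)

𝒫-⊥-∷ᴾ : ∀ {N j} → 𝒫 N j ⊥ (suc N ∷ᴾ S)
𝒫-⊥-∷ᴾ (((_ , 1+N≤N ∷ _) , _) , (_ , refl , _)) = 1+n≰n 1+N≤N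

𝒟-⊥-∷ᴾ : ∀ {N j} → 𝒟 N j ⊥ (suc N ∷ᴾ S)
𝒟-⊥-∷ᴾ ((d , γ≡j) , π∈) = 𝒫-⊥-∷ᴾ ((InD≤⇒InP≤ d , γ≡j) , π∈)

𝒫-split : ∀ {N j s} → suc N ≡ j ℕ.+ s → 𝒫 (suc N) j ≐ (𝒫 N j ∪ (suc N ∷ᴾ 𝒫 (suc N) s))
𝒫-split {N} {j} {s} e = split , merge
  where
  split : 𝒫 (suc N) j ⊆ (𝒫 N j ∪ (suc N ∷ᴾ 𝒫 (suc N) s))
  split (p , γ≡j) with InP≤-split p
  ... | inj₁ p′              = inj₁ (p′ , γ≡j)
  ... | inj₂ (r , refl , p′) = inj₂ (r , refl , p′ , to (γ-∷-⇔ e r) γ≡j)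
  merge : (𝒫 N j ∪ (suc N ∷ᴾ 𝒫 (suc N) s)) ⊆ 𝒫 (suc N) j
  merge (inj₁ (p , γ≡j))            = InP≤-weaken p , γ≡j
  merge (inj₂ (r , refl , p , γ≡s)) = InP≤-∷ p , from (γ-∷-⇔ e r) γ≡s

𝒟-split : ∀ {N j s} → suc N ≡ j ℕ.+ s → 𝒟 (suc N) j ≐ (𝒟 N j ∪ (suc N ∷ᴾ 𝒟 N s))
𝒟-split {N} {j} {s} e = split , merge
  where
  split : 𝒟 (suc N) j ⊆ (𝒟 N j ∪ (suc N ∷ᴾ 𝒟 N s))
  split (d , γ≡j) with InD≤-split d
  ... | inj₁ d′              = inj₁ (d′ , γ≡j)
  ... | inj₂ (r , refl , d′) = inj₂ (r , refl , d′ , to (γ-∷-⇔ e r) γ≡j)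
  merge : (𝒟 N j ∪ (suc N ∷ᴾ 𝒟 N s)) ⊆ 𝒟 (suc N) j
  merge (inj₁ (d , γ≡j))            = InD≤-weaken d , γ≡j
  merge (inj₂ (r , refl , d , γ≡s)) = InD≤-∷ d , from (γ-∷-⇔ e r) γ≡s

count𝒟 : ∀ N j k → Count (𝒟 N j) (qBinom N j) k
count𝒟 N j k with j ≤? N
count𝒟 N       j    k | no j≰N    =
  count-resp ≐-refl (sym (qBinom-above N j (≰⇒> j≰N) k)) (count-∅ (𝒟-empty (≰⇒> j≰N)))
count𝒟 zero    zero k | yes _     = count-resp (≐-sym 𝒟-zero) (sym (qBinom-zero 0 k)) count-[]
count𝒟 (suc N) j    k | yes j≤1+N =
  count-resp (≐-sym (𝒟-split e)) (sym (qBinom-pascal {N} {j} e k))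
    (count-∪ 𝒟-⊥-∷ᴾ (count𝒟 N j k) (count-∷ᴾ proj₂ (λ {k′} _ → count𝒟 N (suc N ∸ j) k′)))
  where
  e : suc N ≡ j ℕ.+ (suc N ∸ j)
  e = sym (m+[n∸m]≡n j≤1+N)

𝒫-counted : ℕ → Set
𝒫-counted k = ∀ N j m → N ≡ j ℕ.+ m → Count (𝒫 N j) (qPoch⁻¹ j ⊛ qPoch⁻¹ m) k

count𝒫-step : ∀ k → (∀ {k′} → k′ < k → 𝒫-counted k′) → 𝒫-counted k
count𝒫-step k rec zero    zero    zero    _ =
  count-resp (≐-sym 𝒫-zero) (sym (trans (⊛-cong qPoch⁻¹-zero qPoch⁻¹-zero k) (⊛-identityˡ one k)))
    count-[]
count𝒫-step k rec (suc N) j       (suc m) e =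
  count-resp (≐-sym (𝒫-split e)) (sym (qPoch⁻¹-⊛-suc j m k))
    (count-∪ 𝒫-⊥-∷ᴾ
      (count𝒫-step k rec N j m (suc-injective (trans e (+-suc j m))))
      (count-∷ᴾ proj₂ (λ {k′} k≡ → rec (k′<k k≡) (suc N) (suc m) j (trans e (+-comm j (suc m))))))
  where
  k′<k : ∀ {k′} → k ≡ suc m ℕ.+ k′ → k′ < k
  k′<k {k′} refl = m<n+m k′ (s≤s z≤n)
-- Here π = (N + 1) ∷ r with γ r = 0, so ℰ π = ℰ r: the recursive call keeps k and N but lowers j.
count𝒫-step k rec (suc N) (suc j) zero    e with suc-injective (trans e (+-identityʳ (suc j)))
... | refl =
  count-resp (≐-sym (𝒫-split e)) (trans (ℤ.+-identityˡ (Q k)) (⊛-comm (qPoch⁻¹ 0) (qPoch⁻¹ (suc N)) k))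
    (count-∪ 𝒫-⊥-∷ᴾ (count-∅ (𝒫-empty ≤-refl))
      (count-∷ᴾ proj₂ (λ { refl → count𝒫-step k rec (suc N) zero (suc N) refl })))
  where
  Q : Series
  Q = qPoch⁻¹ 0 ⊛ qPoch⁻¹ (suc N)

count𝒫 : ∀ N j m → N ≡ j ℕ.+ m → ∀ k → Count (𝒫 N j) (qPoch⁻¹ j ⊛ qPoch⁻¹ m) k
count𝒫 N j m e k = <-rec 𝒫-counted count𝒫-step k N j m e

theorem5p3 : (N j : ℕ) →
    GenFun (λ π → InD≤ N π × γ π ≡ + j) (qBinom N j)
    × (j ≤ N → GenFun (λ π → InP≤ N π × γ π ≡ + j) (inv (qPoch j) ⊛ inv (qPoch (N ∸ j))))
theorem5p3 N j =
  genFun (count𝒟 N j) ,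
  λ j≤N → genFun (count𝒫 N j (N ∸ j) (sym (m+[n∸m]≡n j≤N)))
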